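{- Suppose the input graph is a tree, revealed in an admissible order $v_1,\dots,v_n$, and the algorithm $2$-DOMINATE is run on it. If $\deg(v_i)\ge 3$, then $v_i$ is selected by $2$-DOMINATE.
   Context: Online dominating set model: a finite connected simple undirected graph $G$ is revealed in an order $v_1,\dots,v_n$ such that for every $i$ the subgraph induced on $\{v_1,\dots,v_i\}$ is connected; at step $i$, $v_i$ is revealed together with its entire closed neighbourhood $N[v_i]$, and the algorithm irrevocably decides whether to select $v_i$. Notation: $R_i=\{v_1,\dots,v_i\}$, $V_i=N[R_i]$; $S_i$ = vertices among $v_1,\dots,v_i$ selected, $S_0=\emptyset$; $D_i=N[S_i]$; $U_i=V_i\setminus D_{i-1}$. $v_j$ saves $v_i$ if $j=\max\{k: v_k\in N[v_i]\}$ and $N[v_i]\setminus\{v_j\}$ contains no vertex of $S_{j-1}$; $s(v_j)$ is the set of vertices saved by $v_j$. The algorithm $k$-DOMINATE selects $v_i$ iff $|N(v_i)\cap U_i|\ge k$ or $|s(v_i)|\ge1$. -}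

module Defs where

open import Data.Nat using (ℕ; zero; suc; _≤_; _≤ᵇ_; _≡ᵇ_)
open import Data.Fin using (Fin; toℕ; _≟_)
open import Data.Bool using (Bool; true; false; _∧_; _∨_; not; if_then_else_)
open import Data.List using (List; []; _∷_; length; allFin; _∷ʳ_)
open import Data.Bool.ListAction using (any; all)
open import Data.List.Relation.Unary.Linked using (Linked)
open import Data.List.Relation.Unary.Unique.Propositional using (Unique)
open import Data.Product using (_×_)
open import Data.Unit using (⊤)
open import Relation.Nullary using (¬_)
open import Relation.Nullary.Decidable using (⌊_⌋)
open import Relation.Binary.PropositionalEquality using (_≡_)

-- A finite simple undirected graph on vertex set Fin n.
-- Convention: vertex i (as an element of Fin n) is the vertex revealed at
-- step i (0-indexed), i.e. v_{i+1} in the paper's notation.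
record Graph (n : ℕ) : Set where
  field
    adj    : Fin n → Fin n → Bool
    irrefl : ∀ u → adj u u ≡ false
    sym    : ∀ u v → adj u v ≡ adj v u
open Graph public

module _ {n : ℕ} (G : Graph n) where

  Adj : Fin n → Fin n → Set
  Adj u v = adj G u v ≡ true

  data WalkIn (P : Fin n → Set) : Fin n → Fin n → Set where
    here : ∀ {u} → P u → WalkIn P u u
    step : ∀ {u v w} → P u → Adj u v → WalkIn P v w → WalkIn P u w

  ConnectedOn : (Fin n → Set) → Set
  ConnectedOn P = ∀ u v → P u → P v → WalkIn P u v

  Connected : Set
  Connected = ConnectedOn (λ _ → ⊤)

  IsCycle : Fin n → List (Fin n) → Set
  IsCycle x xs = (2 ≤ length xs) × Unique (x ∷ xs) × Linked Adj ((x ∷ xs) ∷ʳ x)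

  Acyclic : Set
  Acyclic = ∀ x xs → ¬ IsCycle x xs

  IsTree : Set
  IsTree = Connected × Acyclic

  Admissible : Set
  Admissible = ∀ (i : ℕ) → ConnectedOn (λ u → toℕ u Data.Nat.< i)

  countᵇ : (Fin n → Bool) → List (Fin n) → ℕ
  countᵇ p []       = 0
  countᵇ p (x ∷ xs) = if p x then suc (countᵇ p xs) else countᵇ p xs

  degree : Fin n → ℕ
  degree v = countᵇ (adj G v) (allFin n)

  eqᵇ : Fin n → Fin n → Bool
  eqᵇ u w = ⌊ u ≟ w ⌋

  cadj : Fin n → Fin n → Bool
  cadj u w = eqᵇ u w ∨ adj G u w

  dominated : (Fin n → Bool) → Fin n → Bool
  dominated S w = any (λ u → S u ∧ cadj u w) (allFin n)

  -- v saves w, given S = S_{j-1} (the vertices selected before v = v_j):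
  -- w ∈ N[v], v has the largest index in N[w], and no vertex of
  -- N[w] ∖ {v} lies in S
  saves : (Fin n → Bool) → Fin n → Fin n → Bool
  saves S v w =
    cadj v w
    ∧ all (λ u → not (cadj w u) ∨ (toℕ u ≤ᵇ toℕ v)) (allFin n)
    ∧ all (λ u → not (cadj w u) ∨ eqᵇ u v ∨ not (S u)) (allFin n)

  -- the k-DOMINATE rule at vertex v, given S = S_{i-1}:
  -- |N(v) ∩ U_i| ≥ k  or  |s(v)| ≥ 1, where U_i = V_i ∖ D_{i-1}
  -- (N(v) ⊆ V_i, so N(v) ∩ U_i = N(v) ∖ N[S_{i-1}])
  decide : ℕ → (Fin n → Bool) → Fin n → Bool
  decide k S v =
    (k ≤ᵇ countᵇ (λ w → adj G v w ∧ not (dominated S w)) (allFin n))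
    ∨ any (saves S v) (allFin n)

  -- run k i = characteristic function of S_i (vertices with index < i
  -- selected by k-DOMINATE)
  run : ℕ → ℕ → Fin n → Bool
  run k zero    u = false
  run k (suc i) u = if toℕ u ≡ᵇ i then decide k (run k i) u else run k i u

  selected : ℕ → Fin n → Bool
  selected k v = run k (suc (toℕ v)) v

module Submission where

-- Let i be the position of v in the order.  The first i revealed vertices induce a connected
-- subtree T not containing v, so by acyclicity v has at most one neighbour in T: all but at most
-- one neighbour of v are revealed after v.  None of those is dominated by S_{i-1}: a selected
-- vertex u of T adjacent to such a neighbour x, together with the neighbour of v in T (which
-- exists since T is non-empty), would close a cycle through T, v and x.  Hence
-- |N(v) ∩ U_i| ≥ deg v − 1, and v is selected by k-DOMINATE whenever k < deg v.

open import Defs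
open import Data.Nat using (ℕ; zero; suc; _≤_; _<_; _+_; _≡ᵇ_; _<ᵇ_; z≤n; s≤s)
open import Data.Nat.Properties
  using (≤-refl; ≤-trans; n<1+n; ≤-reflexive; n≤1+n; m≤n⇒m≤1+n; m≤n+m; ≤-pred; +-comm; +-suc;
         +-mono-≤; +-monoˡ-≤; +-monoʳ-≤; <-irrefl; <-asym; <-cmp; ≤∧≢⇒<; ≡⇒≡ᵇ; ≡ᵇ⇒≡; <⇒<ᵇ; <ᵇ⇒<; ≤⇒≤ᵇ)
open import Data.Fin using (Fin; toℕ; _≟_)
open import Data.Fin.Properties using (toℕ-injective)
open import Data.Bool using (Bool; true; false; _∧_; _∨_; not; T)
open import Data.Bool.Properties using (T-≡; T-∧)
open import Data.Bool.ListAction using (any)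
open import Data.List using (List; []; _∷_; _++_; _∷ʳ_; length; last; allFin)
open import Data.List.Properties using (++-assoc; length-++)
open import Data.List.Membership.Propositional using (_∈_)
open import Data.List.Relation.Unary.All as All using (All; []; _∷_)
open import Data.List.Relation.Unary.All.Properties using (¬Any⇒All¬)
open import Data.List.Relation.Unary.Any using (here; there; satisfied)
open import Data.List.Relation.Unary.Any.Properties using (any⁻)
open import Data.List.Relation.Unary.AllPairs using ([]; _∷_)
open import Data.List.Relation.Unary.Linked using (Linked; []; [-]; _∷_)
open import Data.List.Relation.Unary.Unique.Propositional using (Unique)
import Data.List.Relation.Unary.Unique.Propositional.Properties as Unique
open import Data.Maybe using (just)
open import Data.Product using (∃; _×_; _,_; proj₂)
open import Data.Sum using (_⊎_; inj₁; inj₂)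
open import Data.Empty using (⊥; ⊥-elim)
open import Function using (_∘_)
open import Function.Bundles using (Equivalence)
open import Relation.Binary.Definitions using (tri<; tri≈; tri>)
open import Relation.Nullary using (¬_; yes; no)
open import Relation.Binary.PropositionalEquality using (_≡_; refl; trans; cong; subst) renaming (sym to ≡-sym)

∧-true : ∀ {a b} → a ∧ b ≡ true → a ≡ true × b ≡ true
∧-true {true} {true} _ = refl , refl

linked-++ : ∀ {A : Set} {R : A → A → Set} {xs ys : List A} {b : A} →
            Linked R xs → last xs ≡ just b → Linked R (b ∷ ys) → Linked R (xs ++ ys)
linked-++ [-]      refl    Rbys = Rbys
linked-++ (r ∷ rs) last≡b  Rbys = r ∷ linked-++ rs last≡b Rbys

module _ {n : ℕ} (G : Graph n) where

  open import Data.List.Membership.DecPropositional (_≟_ {n}) using (_∈?_)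

  Adj-sym : ∀ {u w} → Adj G u w → Adj G w u
  Adj-sym {u} {w} u~w = trans (Graph.sym G w u) u~w

  Adj-irrefl : ∀ {u} → ¬ Adj G u u
  Adj-irrefl {u} u~u with trans (≡-sym u~u) (Graph.irrefl G u)
  ... | ()

  walk-head : ∀ {P a b} → WalkIn G P a b → P a
  walk-head (here pa)       = pa
  walk-head (step pa _ _)   = pa

  record Path (P : Fin n → Set) (a b : Fin n) : Set where
    constructor path
    field
      rest   : List (Fin n)
      unique : Unique (a ∷ rest)
      within : All P (a ∷ rest)
      linked : Linked (Adj G) (a ∷ rest)
      ends   : last (a ∷ rest) ≡ just b

  suffix-path : ∀ {P b u} xs → Unique xs → All P xs → Linked (Adj G) xs →
                last xs ≡ just b → u ∈ xs → Path P u b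
  suffix-path (x ∷ xs) uq al lk ls (here refl) = path xs uq al lk ls
  suffix-path (x ∷ []) uq al lk ls (there ())
  suffix-path (x ∷ y ∷ xs) (_ ∷ uq) (_ ∷ al) (_ ∷ lk) ls (there u∈) = suffix-path (y ∷ xs) uq al lk ls u∈

  walk⇒path : ∀ {P a b} → WalkIn G P a b → Path P a b
  walk⇒path (here pa) = path [] ([] ∷ []) (pa ∷ []) [-] refl
  walk⇒path {a = a} (step {v = u} pa a~u walk) with walk⇒path walk
  ... | path rest uq al lk ls with a ∈? (u ∷ rest)
  ...   | yes a∈ = suffix-path (u ∷ rest) uq al lk ls a∈
  ...   | no  a∉ = path (u ∷ rest) (¬Any⇒All¬ _ a∉ ∷ uq) (pa ∷ al) (a~u ∷ lk) ls

  path-detour⇒cycle : ∀ {P a b} (p : Path P a b) (detour : List (Fin n)) →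
                      Unique detour → All (¬_ ∘ P) detour → Linked (Adj G) (b ∷ (detour ∷ʳ a)) →
                      2 ≤ length (Path.rest p) + length detour →
                      IsCycle G a (Path.rest p ++ detour)
  path-detour⇒cycle {a = a} (path rest uq al lk ls) detour uqᵈ ¬alᵈ lkᵈ len =
      subst (2 ≤_) (≡-sym (length-++ rest)) len
    , Unique.++⁺ uq uqᵈ (λ (x∈ , x∈ᵈ) → All.lookup ¬alᵈ x∈ᵈ (All.lookup al x∈))
    , subst (Linked (Adj G)) (cong (a ∷_) (≡-sym (++-assoc rest detour (a ∷ []))))
            (linked-++ lk ls lkᵈ)

  module _ (acyclic : Acyclic G) {P : Fin n → Set} (connected : ConnectedOn G P) where

    outside-neighbour-unique : ∀ {v a b} → ¬ P v → P a → P b → Adj G v a → Adj G v b → a ≡ b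
    outside-neighbour-unique {v} {a} {b} ¬pv pa pb v~a v~b with walk⇒path (connected a b pa pb)
    ... | path [] _ _ _ refl = refl
    ... | p@(path (_ ∷ rest) _ _ _ _) =
      ⊥-elim (acyclic a _ (path-detour⇒cycle p (v ∷ []) ([] ∷ []) (¬pv ∷ [])
                            (Adj-sym v~b ∷ v~a ∷ [-]) (s≤s (m≤n+m 1 (length rest)))))

    outside-edge-no-return : ∀ {u p v w} → P u → P p → ¬ P v → ¬ P w → ¬ v ≡ w →
                             Adj G p v → Adj G v w → Adj G w u → ⊥
    outside-edge-no-return {u} {p} {v} {w} pu pp ¬pv ¬pw v≢w p~v v~w w~u
      with walk⇒path (connected u p pu pp)
    ... | q@(path rest _ _ _ _) =
      acyclic u _ (path-detour⇒cycle q (v ∷ w ∷ []) ((v≢w ∷ []) ∷ [] ∷ []) (¬pv ∷ ¬pw ∷ [])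
                     (p~v ∷ v~w ∷ w~u ∷ [-]) (m≤n+m 2 (length rest)))

  count-∷ : ∀ p x xs → countᵇ G p xs ≤ countᵇ G p (x ∷ xs)
  count-∷ p x xs with p x
  ... | true  = n≤1+n _
  ... | false = ≤-refl

  count-mono : ∀ {p q} xs → (∀ x → p x ≡ true → q x ≡ true) → countᵇ G p xs ≤ countᵇ G q xs
  count-mono [] p⇒q = ≤-refl
  count-mono {p} {q} (x ∷ xs) p⇒q with p x in px
  ... | false = ≤-trans (count-mono xs p⇒q) (count-∷ q x xs)
  ... | true rewrite p⇒q x px = s≤s (count-mono xs p⇒q)

  count-∨ : ∀ {p q r} xs → (∀ x → p x ≡ true → q x ≡ true ⊎ r x ≡ true) →
            countᵇ G p xs ≤ countᵇ G q xs + countᵇ G r xs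
  count-∨ [] p⇒q∨r = ≤-refl
  count-∨ {p} {q} {r} (x ∷ xs) p⇒q∨r with p x in px
  ... | false = ≤-trans (count-∨ xs p⇒q∨r) (+-mono-≤ (count-∷ q x xs) (count-∷ r x xs))
  ... | true with p⇒q∨r x px
  ...   | inj₁ qx rewrite qx = s≤s (≤-trans (count-∨ xs p⇒q∨r) (+-monoʳ-≤ _ (count-∷ r x xs)))
  ...   | inj₂ rx rewrite rx =
    ≤-trans (s≤s (≤-trans (count-∨ xs p⇒q∨r) (+-monoˡ-≤ _ (count-∷ q x xs))))
            (≤-reflexive (≡-sym (+-suc _ _)))

  count-false : ∀ {p} xs → All (λ x → p x ≡ false) xs → countᵇ G p xs ≡ 0
  count-false [] [] = refl
  count-false (x ∷ xs) (px ∷ pxs) rewrite px = count-false xs pxs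

  count-unique-≤1 : ∀ {p} xs → Unique xs → (∀ x y → p x ≡ true → p y ≡ true → x ≡ y) →
                    countᵇ G p xs ≤ 1
  count-unique-≤1 [] _ p-unique = z≤n
  count-unique-≤1 {p} (x ∷ xs) (x∉xs ∷ uq) p-unique with p x in px
  ... | false = count-unique-≤1 xs uq p-unique
  ... | true  = ≤-reflexive (cong suc (count-false xs (All.map ¬p x∉xs)))
    where
    ¬p : ∀ {y} → ¬ x ≡ y → p y ≡ false
    ¬p {y} x≢y with p y in py
    ... | false = refl
    ... | true  = ⊥-elim (x≢y (p-unique x y px py))

  run-< : ∀ k i u → run G k i u ≡ true → toℕ u < i
  run-< k zero    u ()
  run-< k (suc i) u u∈S with toℕ u ≡ᵇ i in u≡i
  ... | true  = ≤-reflexive (cong suc (≡ᵇ⇒≡ (toℕ u) i (Equivalence.from T-≡ u≡i)))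
  ... | false = m≤n⇒m≤1+n (run-< k i u u∈S)

  selected≡decide : ∀ k v → selected G k v ≡ decide G k (run G k (toℕ v)) v
  selected≡decide k v rewrite Equivalence.to T-≡ (≡⇒≡ᵇ (toℕ v) (toℕ v) refl) = refl

  cadj⇒≡⊎Adj : ∀ {u w} → T (cadj G u w) → u ≡ w ⊎ Adj G u w
  cadj⇒≡⊎Adj {u} {w} u~w with u ≟ w
  ... | yes u≡w = inj₁ u≡w
  ... | no  _   = inj₂ (Equivalence.to T-≡ u~w)

  dominated-by-run : ∀ k i x → dominated G (run G k i) x ≡ true →
                     ∃ λ u → toℕ u < i × (u ≡ x ⊎ Adj G u x)
  dominated-by-run k i x dom with satisfied (any⁻ _ (allFin n) (Equivalence.from T-≡ dom))
  ... | u , u∈S∧u~x with Equivalence.to T-∧ u∈S∧u~x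
  ...   | u∈S , u~x = u , run-< k i u (Equivalence.to T-≡ u∈S) , cadj⇒≡⊎Adj u~x

  module _ (tree : IsTree G) (admissible : Admissible G) (v : Fin n) where

    Earlier : Fin n → Set
    Earlier u = toℕ u < toℕ v

    v-not-earlier : ¬ Earlier v
    v-not-earlier = <-irrefl refl

    earlier-neighbour-unique : ∀ {a b} → Earlier a → Earlier b → Adj G v a → Adj G v b → a ≡ b
    earlier-neighbour-unique =
      outside-neighbour-unique (proj₂ tree) (admissible (toℕ v)) v-not-earlier

    -- A walk from v to u inside the prefix ending at v leaves v towards an earlier vertex.
    earlier-neighbour : ∀ {u} → Earlier u → ∃ λ p → Earlier p × Adj G p v
    earlier-neighbour u<v with admissible (suc (toℕ v)) v _ (n<1+n _) (m≤n⇒m≤1+n u<v)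
    ... | here _ = ⊥-elim (v-not-earlier u<v)
    ... | step {v = p} _ v~p walk =
      p , ≤∧≢⇒< (≤-pred (walk-head walk)) p≢v , Adj-sym v~p
      where
      p≢v : ¬ toℕ p ≡ toℕ v
      p≢v p≡v = Adj-irrefl (subst (Adj G v) (toℕ-injective p≡v) v~p)

    -- A dominator u of x and the earlier neighbour p of v would close the cycle u ⋯ p v x u.
    later-neighbour-undominated : ∀ k {x} → Adj G v x → toℕ v < toℕ x →
                                  dominated G (run G k (toℕ v)) x ≡ false
    later-neighbour-undominated k {x} v~x v<x with dominated G (run G k (toℕ v)) x in dom
    ... | false = refl
    ... | true with dominated-by-run k (toℕ v) x dom
    ...   | u , u<v , inj₁ refl = ⊥-elim (<-asym u<v v<x)
    ...   | u , u<v , inj₂ u~x with earlier-neighbour u<v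
    ...     | p , p<v , p~v =
      ⊥-elim (outside-edge-no-return (proj₂ tree) (admissible (toℕ v)) u<v p<v v-not-earlier
                (<-asym v<x) (λ { refl → <-irrefl refl v<x }) p~v v~x (Adj-sym u~x))

    laterNeighbour earlierNeighbour : Fin n → Bool
    laterNeighbour   w = adj G v w ∧ (toℕ v <ᵇ toℕ w)
    earlierNeighbour w = adj G v w ∧ (toℕ w <ᵇ toℕ v)

    neighbour-later-or-earlier : ∀ w → adj G v w ≡ true →
                                 laterNeighbour w ≡ true ⊎ earlierNeighbour w ≡ true
    neighbour-later-or-earlier w v~w with <-cmp (toℕ w) (toℕ v)
    ... | tri< w<v _ _ rewrite v~w | Equivalence.to T-≡ (<⇒<ᵇ w<v) = inj₂ refl
    ... | tri> _ _ v<w rewrite v~w | Equivalence.to T-≡ (<⇒<ᵇ v<w) = inj₁ refl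
    ... | tri≈ _ w≡v _ = ⊥-elim (Adj-irrefl (subst (Adj G v) (toℕ-injective w≡v) v~w))

    earlierNeighbour-unique : ∀ a b → earlierNeighbour a ≡ true → earlierNeighbour b ≡ true → a ≡ b
    earlierNeighbour-unique a b ea eb with ∧-true {adj G v a} ea | ∧-true {adj G v b} eb
    ... | v~a , a<v | v~b , b<v =
      earlier-neighbour-unique (<ᵇ⇒< _ _ (Equivalence.from T-≡ a<v))
                               (<ᵇ⇒< _ _ (Equivalence.from T-≡ b<v)) v~a v~b

    degree≤1+later : degree G v ≤ suc (countᵇ G laterNeighbour (allFin n))
    degree≤1+later = ≤-trans (count-∨ (allFin n) neighbour-later-or-earlier)
      (≤-trans (+-monoʳ-≤ _ (count-unique-≤1 (allFin n) (Unique.allFin⁺ n) earlierNeighbour-unique))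
               (≤-reflexive (+-comm _ 1)))

    undominatedNeighbour : ℕ → Fin n → Bool
    undominatedNeighbour k w = adj G v w ∧ not (dominated G (run G k (toℕ v)) w)

    laterNeighbour⇒undominated : ∀ k x → laterNeighbour x ≡ true → undominatedNeighbour k x ≡ true
    laterNeighbour⇒undominated k x later with ∧-true {adj G v x} later
    ... | v~x , v<x rewrite v~x
                          | later-neighbour-undominated k v~x (<ᵇ⇒< _ _ (Equivalence.from T-≡ v<x)) = refl

    undominated-neighbours-≥ : ∀ k → k < degree G v → k ≤ countᵇ G (undominatedNeighbour k) (allFin n)
    undominated-neighbours-≥ k k<degree =
      ≤-trans (≤-pred (≤-trans k<degree degree≤1+later))
              (count-mono (allFin n) (laterNeighbour⇒undominated k))

    k<degree⇒selected : ∀ k → k < degree G v → selected G k v ≡ true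
    k<degree⇒selected k k<degree =
      trans (selected≡decide k v)
            (cong (_∨ any (saves G (run G k (toℕ v)) v) (allFin n))
                  (Equivalence.to T-≡ (≤⇒≤ᵇ (undominated-neighbours-≥ k k<degree))))

corollary1 : {n : ℕ} (G : Graph n) → IsTree G → Admissible G →
    (v : Fin n) → 3 ≤ degree G v → selected G 2 v ≡ true
corollary1 G tree admissible v = k<degree⇒selected G tree admissible v 2
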